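{- Let $G$ be a tree on $k\ge2$ vertices and $n\ge1$. If $G$ has a perfect matching, then the number of perfect matchings of $\Gamma^G_n$ is \[ 2^{\frac{k}{2(k-1)}\left(k^n-2k^{n-1}+1\right)} ; \] if $G$ has no perfect matching, then $\Gamma^G_n$ has no perfect matching.
   Context: Let $G$ be a finite tree with vertex set $V$, $|V|=k$, and fix an orientation of each edge. For an oriented edge $e=(s,t)$ of $G$ define a bijection $e$ of the set $V^n$ of words of length $n$ over $V$ recursively: $e$ fixes the empty word, and for a letter $z\in V$ and a word $w$, $e(sw)=t\,e(w)$, $e(tw)=sw$, and $e(zw)=zw$ for $z\notin\{s,t\}$. The $n$-th Schreier graph $\Gamma^G_n$ is the multigraph with vertex set $V^n$ having, for each word $u\in V^n$ and each edge $e$ of $G$, one edge labelled $e$ joining $u$ and $e(u)$ (so fixed points give loops and orbits of size $2$ give two distinct parallel edges). A perfect matching of a multigraph is a set $M$ of non-loop edges such that every vertex is an endpoint of exactly one edge of $M$; parallel edges are regarded as distinct edges. -}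

module Defs where

open import Data.Nat using (ℕ)
open import Data.Bool using (Bool; true)
open import Data.Fin using (Fin; _≟_)
open import Data.Vec using (Vec; []; _∷_)
open import Data.List using (List; []; _∷_; length)
open import Data.List.Relation.Unary.All using (All)
open import Data.List.Relation.Unary.Any using (Any)
open import Data.List.Relation.Unary.AllPairs using (AllPairs)
open import Data.List.Relation.Unary.Unique.Propositional using (Unique)
open import Data.Product using (Σ; _×_; _,_; proj₁; proj₂)
open import Data.Sum using (_⊎_)
open import Relation.Binary.PropositionalEquality using (_≡_; _≢_)
open import Relation.Nullary using (¬_; yes; no)

record Multigraph : Set₁ where
  field
    V : Set
    E : Set
    ends : E → V × V
open Multigraph public

Incident : (Γ : Multigraph) → V Γ → E Γ → Set
Incident Γ v e = (v ≡ proj₁ (ends Γ e)) ⊎ (v ≡ proj₂ (ends Γ e))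

IsPerfectMatching : (Γ : Multigraph) → (E Γ → Bool) → Set
IsPerfectMatching Γ M =
  (∀ e → M e ≡ true → proj₁ (ends Γ e) ≢ proj₂ (ends Γ e)) ×
  (∀ v → Σ (E Γ) λ e → (M e ≡ true) × Incident Γ v e ×
            (∀ e' → M e' ≡ true → Incident Γ v e' → e' ≡ e))

HasPerfectMatching : Multigraph → Set
HasPerfectMatching Γ = Σ (E Γ → Bool) (IsPerfectMatching Γ)

NumPerfectMatchings : Multigraph → ℕ → Set
NumPerfectMatchings Γ N =
  Σ (List (E Γ → Bool)) λ L →
    (length L ≡ N) ×
    All (IsPerfectMatching Γ) L ×
    (∀ M → IsPerfectMatching Γ M → Any (λ M' → ∀ e → M e ≡ M' e) L) ×
    AllPairs (λ M₁ M₂ → ¬ (∀ e → M₁ e ≡ M₂ e)) L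

data Walk (Γ : Multigraph) : V Γ → V Γ → Set where
  nil  : ∀ {v} → Walk Γ v v
  cons : ∀ {u w} (e : E Γ) (v : V Γ) →
         ((proj₁ (ends Γ e) ≡ u × proj₂ (ends Γ e) ≡ v) ⊎
          (proj₁ (ends Γ e) ≡ v × proj₂ (ends Γ e) ≡ u)) →
         Walk Γ v w → Walk Γ u w

walkEdges : ∀ {Γ u w} → Walk Γ u w → List (E Γ)
walkEdges nil = []
walkEdges (cons e _ _ p) = e ∷ walkEdges p

Connected : Multigraph → Set
Connected Γ = ∀ u v → Walk Γ u v

Acyclic : Multigraph → Set
Acyclic Γ = ∀ v (p : Walk Γ v v) → Unique (walkEdges p) → walkEdges p ≡ []

IsTree : Multigraph → Set
IsTree Γ = Connected Γ × Acyclic Γ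

graphOf : ∀ {k m} → (Fin m → Fin k × Fin k) → Multigraph
graphOf {k} {m} edge = record { V = Fin k ; E = Fin m ; ends = edge }

act : ∀ {k n} → Fin k × Fin k → Vec (Fin k) n → Vec (Fin k) n
act (s , t) [] = []
act (s , t) (z ∷ w) with z ≟ s | z ≟ t
... | yes _ | _     = t ∷ act (s , t) w
... | no _  | yes _ = s ∷ w
... | no _  | no _  = z ∷ w

Schreier : ∀ {k m} → (Fin m → Fin k × Fin k) → ℕ → Multigraph
Schreier {k} {m} edge n = record
  { V = Vec (Fin k) n
  ; E = Vec (Fin k) n × Fin m
  ; ends = λ { (u , i) → (u , act (edge i) u) } }

{-# OPTIONS --safe #-}
-- A perfect matching of Γⁿ (words of length n = l + 1) joins every word x to a partner
-- through an edge labelled by an edge i of G, and the first letters of x and of its partner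
-- are the two endpoints of i. Call the words with first letter v the copy of v. The label
-- of x depends only on its copy: otherwise the labels used by some, but not all, words of
-- the copies of their endpoints form a leafless edge set of the forest G, which must be
-- empty. (The partner map is injective, so by pigeonhole a label that fills one copy also
-- fills the copy across the edge.) Hence the labels form a perfect matching μ of G, the
-- only one since G is a forest.
-- Conversely, for an edge i = (s , t) of μ the edges labelled i between the copies of s and
-- t form one cycle for each orbit of the action α of i on words of length l, and each cycle
-- has exactly two perfect matchings. Since α acts as an odometer on the longest prefix over
-- {s , t}, the number c of orbits satisfies c₀ = 1 and c₍ₗ₊₁₎ = cₗ + (k − 2) kˡ. So there are
-- 2 ^ (c k / 2) perfect matchings, and (k − 1) c = kⁿ − 2 kⁿ⁻¹ + 1.
module Submission where

open import Defs
open import Data.Nat using (ℕ; zero; suc; _≤_; _*_; _+_; _∸_; _^_; s≤s)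
open import Data.Fin using (Fin)
open import Data.Product using (Σ; _×_)
open import Relation.Binary.PropositionalEquality using (_≡_)
open import Relation.Nullary using (¬_)

open import Data.Bool using (Bool; true; false; not; if_then_else_)
import Data.Bool as Bool
open import Data.Bool.Properties using (not-involutive; ¬-not)
open import Data.Fin as Fin using (zero; suc; _≟_)
open import Data.Fin.Properties as FinP using (injective⇒≤; cantor-schröder-bernstein)
open import Data.List as List using (List; []; _∷_; _++_; length; map; concatMap; cartesianProductWith; filter; allFin)
open import Data.List.Properties
  using (length-++; length-map; length-tabulate; ++-assoc; ++-conicalʳ; ∷-injectiveˡ)
open import Data.List.Membership.Propositional using (_∈_; _∉_; find; lose)
open import Data.List.Membership.Propositional.Properties
  using ( ∈-lookup; ∈-allFin; ∈-map⁺; ∈-map⁻; ∈-++⁺ˡ; ∈-++⁺ʳ; ∈-++⁻; ∈-filter⁺; ∈-filter⁻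
        ; ∈-cartesianProductWith⁺; ∈-cartesianProductWith⁻; ∈-concatMap⁺; ∈-concatMap⁻)
open import Data.List.Relation.Binary.Disjoint.Propositional using (Disjoint)
open import Data.List.Relation.Unary.All as All using (All; []; _∷_)
import Data.List.Relation.Unary.All.Properties as All
open import Data.List.Relation.Unary.AllPairs as AllPairs using (AllPairs; []; _∷_)
import Data.List.Relation.Unary.AllPairs.Properties as AllPairs
open import Data.List.Relation.Unary.Any as Any using (Any; here; there)
open import Data.List.Relation.Unary.Any.Properties as Any using (lookup-index)
open import Data.List.Relation.Unary.Unique.Propositional using (Unique)
import Data.List.Relation.Unary.Unique.Propositional.Properties as Unique
import Data.List.Relation.Unary.Unique.Setoid as UniqueS
import Data.List.Relation.Unary.Unique.Setoid.Properties as UniqueS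
import Data.Nat.Properties as ℕ
open import Data.Nat.Tactic.RingSolver using (solve-∀)
open import Data.Product using (_,_; proj₁; proj₂; ∃; uncurry)
open import Data.Product.Function.NonDependent.Propositional using (_×-↔_)
import Data.Product.Properties as ProdP
open import Data.Sum using (_⊎_; inj₁; inj₂)
open import Data.Vec as Vec using (Vec; []; _∷_; head; tail)
import Data.Vec.Properties as VecP
open import Function using (_∘_; id; case_of_; Injective; _↔_; Inverse; mk↔ₛ′)
open import Function.Properties.Inverse using (↔-refl; ↔-sym; ↔-trans)
open import Relation.Binary using (DecidableEquality; Setoid)
open import Relation.Binary.PropositionalEquality
  using (_≢_; refl; sym; trans; cong; cong₂; subst; module ≡-Reasoning)
import Relation.Binary.PropositionalEquality as ≡
open import Relation.Nullary using (Dec; yes; no; does; ¬?; contradiction)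
open import Relation.Nullary.Decidable using (_×-dec_; _⊎-dec_)
open import Relation.Unary using (Decidable)

module _ {A : Set} where

  lookup-injective : {xs : List A} → Unique xs → Injective _≡_ _≡_ (List.lookup xs)
  lookup-injective (_ ∷ _)     {zero}  {zero}  _  = refl
  lookup-injective (x∉xs ∷ _) {zero}  {suc j} eq = contradiction eq (All.lookup x∉xs (∈-lookup j))
  lookup-injective (x∉xs ∷ _) {suc i} {zero}  eq = contradiction (sym eq) (All.lookup x∉xs (∈-lookup i))
  lookup-injective (_ ∷ xs!)   {suc i} {suc j} eq = cong suc (lookup-injective xs! eq)

  unique-++⁻ˡ : ∀ (xs : List A) {ys} → Unique (xs ++ ys) → Unique xs
  unique-++⁻ˡ []       _              = []
  unique-++⁻ˡ (x ∷ xs) (x∉ ∷ xs++ys!) = All.++⁻ˡ xs x∉ ∷ unique-++⁻ˡ xs xs++ys!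

unique⇒length≤ : ∀ {n} {xs : List (Fin n)} → Unique xs → length xs ≤ n
unique⇒length≤ xs! = injective⇒≤ (lookup-injective xs!)

unique∧complete⇒length≡ : ∀ {n} {xs : List (Fin n)} → Unique xs → (∀ x → x ∈ xs) → length xs ≡ n
unique∧complete⇒length≡ {xs = xs} xs! complete =
  cantor-schröder-bernstein (lookup-injective xs!) index-injective
  where
  index-injective : Injective _≡_ _≡_ (λ x → Any.index (complete x))
  index-injective {x} {y} eq =
    trans (lookup-index (complete x)) (trans (cong (List.lookup xs) eq) (sym (lookup-index (complete y))))

module _ {A B C : Set} where

  length-cartesianProductWith : ∀ (f : A → B → C) xs ys →
    length (cartesianProductWith f xs ys) ≡ length xs * length ys
  length-cartesianProductWith f [] ys = refl
  length-cartesianProductWith f (x ∷ xs) ys = begin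
    length (map (f x) ys ++ cartesianProductWith f xs ys)          ≡⟨ length-++ (map (f x) ys) ⟩
    length (map (f x) ys) + length (cartesianProductWith f xs ys)
      ≡⟨ cong₂ _+_ (length-map (f x) ys) (length-cartesianProductWith f xs ys) ⟩
    length ys + length xs * length ys                               ∎
    where open ≡-Reasoning

module _ {A B : Set} (f : A → List B) where

  length-concatMap-const : ∀ {c} → (∀ x → length (f x) ≡ c) →
                           ∀ xs → length (concatMap f xs) ≡ length xs * c
  length-concatMap-const eq [] = refl
  length-concatMap-const eq (x ∷ xs) =
    trans (length-++ (f x)) (cong₂ _+_ (eq x) (length-concatMap-const eq xs))

  unique-concatMap : ∀ {xs} → Unique xs → (∀ x → Unique (f x)) →
    (∀ {x y} → x ∈ xs → y ∈ xs → x ≢ y → Disjoint (f x) (f y)) → Unique (concatMap f xs)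
  unique-concatMap []            _  _        = []
  unique-concatMap (x∉xs ∷ xs!) f! disjoint =
    Unique.++⁺ (f! _) (unique-concatMap xs! f! (λ x∈ y∈ → disjoint (there x∈) (there y∈)))
      λ (b∈fx , b∈rest) → let y , y∈xs , b∈fy = find (∈-concatMap⁻ f b∈rest)
                          in disjoint (here refl) (there y∈xs) (All.lookup x∉xs y∈xs) (b∈fx , b∈fy)

fin-injective⇒surjective : ∀ {n} (f : Fin n → Fin n) → Injective _≡_ _≡_ f → ∀ y → ∃ λ x → f x ≡ y
fin-injective⇒surjective {suc n} f f-inj y with FinP.any? (λ x → f x ≟ y)
... | yes hit  = hit
... | no  miss = contradiction (injective⇒≤ g-injective) ℕ.1+n≰n
  where
  y∉image : ∀ x → y ≢ f x
  y∉image x y≡fx = miss (x , sym y≡fx)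
  g : Fin (suc n) → Fin n
  g x = Fin.punchOut (y∉image x)
  g-injective : Injective _≡_ _≡_ g
  g-injective {x} {x′} eq = f-inj (FinP.punchOut-injective (y∉image x) (y∉image x′) eq)

module _ {A : Set} {n : ℕ} (A↔Fin : A ↔ Fin n) where
  open Inverse A↔Fin using (to; from; strictlyInverseˡ; strictlyInverseʳ)

  finite-injective⇒surjective : ∀ (f : A → A) → Injective _≡_ _≡_ f → ∀ y → ∃ λ x → f x ≡ y
  finite-injective⇒surjective f f-inj y =
    let x , fx≡y = fin-injective⇒surjective (to ∘ f ∘ from) to∘f∘from-injective (to y)
    in from x , to-injective fx≡y
    where
    to-injective : Injective _≡_ _≡_ to
    to-injective {a} {b} eq = trans (sym (strictlyInverseʳ a)) (trans (cong from eq) (strictlyInverseʳ b))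
    to∘f∘from-injective : Injective _≡_ _≡_ (to ∘ f ∘ from)
    to∘f∘from-injective {x} {y} eq =
      trans (sym (strictlyInverseˡ x)) (trans (cong to (f-inj (to-injective eq))) (strictlyInverseˡ y))

  finite-¬∀⇒∃¬ : ∀ {P : A → Set} → Decidable P → ¬ (∀ a → P a) → ∃ λ a → ¬ P a
  finite-¬∀⇒∃¬ {P} P? ¬∀P =
    let x , ¬Px = FinP.¬∀⟶∃¬ n (P ∘ from) (P? ∘ from)
                    (λ ∀P → ¬∀P λ a → subst P (strictlyInverseʳ a) (∀P (to a)))
    in from x , ¬Px

module Words (k : ℕ) where

  words : ∀ l → List (Vec (Fin k) l)
  words zero    = [] ∷ []
  words (suc l) = cartesianProductWith _∷_ (allFin k) (words l)

  ∈-words : ∀ {l} (w : Vec (Fin k) l) → w ∈ words l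
  ∈-words []      = here refl
  ∈-words (z ∷ w) = ∈-cartesianProductWith⁺ _∷_ (∈-allFin z) (∈-words w)

  words-unique : ∀ l → Unique (words l)
  words-unique zero    = [] ∷ []
  words-unique (suc l) = Unique.cartesianProductWith⁺ _∷_ VecP.∷-injective (Unique.allFin⁺ k) (words-unique l)

  length-words : ∀ l → length (words l) ≡ k ^ l
  length-words zero    = refl
  length-words (suc l) = begin
    length (cartesianProductWith _∷_ (allFin k) (words l))
      ≡⟨ length-cartesianProductWith _∷_ (allFin k) (words l) ⟩
    length (allFin k) * length (words l)
      ≡⟨ cong₂ _*_ (length-tabulate {n = k} id) (length-words l) ⟩
    k * k ^ l
      ∎
    where open ≡-Reasoning

  word↔Fin : ∀ l → Vec (Fin k) l ↔ Fin (k ^ l)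
  word↔Fin zero    = mk↔ₛ′ (λ _ → zero) (λ _ → []) (λ { zero → refl }) (λ { [] → refl })
  word↔Fin (suc l) = ↔-trans (↔-trans uncons (↔-refl ×-↔ word↔Fin l)) (↔-sym FinP.*↔×)
    where
    uncons : Vec (Fin k) (suc l) ↔ (Fin k × Vec (Fin k) l)
    uncons = mk↔ₛ′ (λ { (z ∷ w) → z , w }) (λ (z , w) → z ∷ w) (λ _ → refl) (λ { (z ∷ w) → refl })

module BooleanFunctions {A : Set} (_≟ᴬ_ : DecidableEquality A) where

  assign : A → Bool → (A → Bool) → A → Bool
  assign a b h x = if does (x ≟ᴬ a) then b else h x

  assign-≡ : ∀ a b h → assign a b h a ≡ b
  assign-≡ a b h with a ≟ᴬ a
  ... | yes _  = refl
  ... | no a≢a = contradiction refl a≢a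

  assign-≢ : ∀ {a} b h {x} → x ≢ a → assign a b h x ≡ h x
  assign-≢ {a} b h {x} x≢a with x ≟ᴬ a
  ... | yes x≡a = contradiction x≡a x≢a
  ... | no _    = refl

  AgreeOn : List A → (A → Bool) → (A → Bool) → Set
  AgreeOn xs g h = ∀ {x} → x ∈ xs → g x ≡ h x

  agreeOn-setoid : List A → Setoid _ _
  agreeOn-setoid xs = record
    { Carrier       = A → Bool
    ; _≈_           = AgreeOn xs
    ; isEquivalence = record
      { refl  = λ _ → refl
      ; sym   = λ g≈h x∈xs → sym (g≈h x∈xs)
      ; trans = λ g≈h h≈i x∈xs → trans (g≈h x∈xs) (h≈i x∈xs)
      }
    }

  functionsOn : List A → List (A → Bool)
  functionsOn []       = (λ _ → false) ∷ []
  functionsOn (a ∷ as) = cartesianProductWith (assign a) (true ∷ false ∷ []) (functionsOn as)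

  length-functionsOn : ∀ xs → length (functionsOn xs) ≡ 2 ^ length xs
  length-functionsOn []       = refl
  length-functionsOn (a ∷ as) =
    trans (length-cartesianProductWith (assign a) (true ∷ false ∷ []) (functionsOn as))
          (cong (2 *_) (length-functionsOn as))

  functionsOn-complete : ∀ xs g → Any (AgreeOn xs g) (functionsOn xs)
  functionsOn-complete []       g = here (λ ())
  functionsOn-complete (a ∷ as) g with h , h∈ , g≈h ← find (functionsOn-complete as g) =
    lose (∈-cartesianProductWith⁺ (assign a) (bool∈ (g a)) h∈) g≈h′
    where
    bool∈ : ∀ b → b ∈ true ∷ false ∷ []
    bool∈ true  = here refl
    bool∈ false = there (here refl)
    g≈h′ : AgreeOn (a ∷ as) g (assign a (g a) h)
    g≈h′ (here refl) = sym (assign-≡ a (g a) h)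
    g≈h′ {x} (there x∈as) with x ≟ᴬ a
    ... | yes refl = refl
    ... | no _     = g≈h x∈as

  functionsOn-unique : ∀ {xs} → Unique xs → UniqueS.Unique (agreeOn-setoid xs) (functionsOn xs)
  functionsOn-unique []             = [] ∷ []
  functionsOn-unique {a ∷ as} (a∉as ∷ as!) =
    UniqueS.cartesianProductWith⁺ (≡.setoid Bool) (agreeOn-setoid as) (agreeOn-setoid (a ∷ as)) (assign a)
      assign-injective (((λ ()) ∷ []) ∷ [] ∷ []) (functionsOn-unique as!)
    where
    assign-injective : ∀ {b b′ h h′} → AgreeOn (a ∷ as) (assign a b h) (assign a b′ h′) →
                       b ≡ b′ × AgreeOn as h h′
    assign-injective {b} {b′} {h} {h′} agree =
        trans (sym (assign-≡ a b h)) (trans (agree (here refl)) (assign-≡ a b′ h′))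
      , λ x∈as → let x≢a = λ { refl → All.lookup a∉as x∈as refl } in
          trans (sym (assign-≢ b h x≢a)) (trans (agree (there x∈as)) (assign-≢ b′ h′ x≢a))

module _ (Γ : Multigraph) (_≟ᴱ_ : DecidableEquality (E Γ)) where
  open BooleanFunctions _≟ᴱ_

  -- The perfect matchings correspond to the Boolean functions on R: D h is the one encoded by h on R.
  numPerfectMatchings-retract :
    (R : List (E Γ)) → Unique R → (D : (E Γ → Bool) → E Γ → Bool) →
    (∀ h → IsPerfectMatching Γ (D h)) →
    (∀ h {e} → e ∈ R → D h e ≡ h e) →
    (∀ g h → AgreeOn R g h → ∀ e → D g e ≡ D h e) →
    (∀ M → IsPerfectMatching Γ M → ∀ e → M e ≡ D M e) →
    NumPerfectMatchings Γ (2 ^ length R)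
  numPerfectMatchings-retract R R! D D-pm D-on-R D-cong pm-fixed =
    map D (functionsOn R) , length-ok , all-pm , complete , distinct
    where
    length-ok : length (map D (functionsOn R)) ≡ 2 ^ length R
    length-ok = trans (length-map D (functionsOn R)) (length-functionsOn R)

    all-pm : All (IsPerfectMatching Γ) (map D (functionsOn R))
    all-pm = All.map⁺ (All.tabulate (λ {h} _ → D-pm h))

    complete : ∀ M → IsPerfectMatching Γ M → Any (λ M′ → ∀ e → M e ≡ M′ e) (map D (functionsOn R))
    complete M pm = Any.map⁺ (Any.map {P = AgreeOn R M} (λ {h} M≈h e → trans (pm-fixed M pm e) (D-cong M h M≈h e))
                                      (functionsOn-complete R M))

    distinct : AllPairs (λ M₁ M₂ → ¬ (∀ e → M₁ e ≡ M₂ e)) (map D (functionsOn R))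
    distinct = AllPairs.map⁺ (AllPairs.map (λ {g} {h} g≉h Dg≡Dh → g≉h λ e∈R →
                 trans (sym (D-on-R g e∈R)) (trans (Dg≡Dh _) (D-on-R h e∈R)))
               (functionsOn-unique R!))

module _ {Γ : Multigraph} {M : E Γ → Bool} (pm : IsPerfectMatching Γ M) where

  matchedEdge : V Γ → E Γ
  matchedEdge v = proj₁ (proj₂ pm v)

  matchedEdge-∈ : ∀ v → M (matchedEdge v) ≡ true
  matchedEdge-∈ v = proj₁ (proj₂ (proj₂ pm v))

  matchedEdge-incident : ∀ v → Incident Γ v (matchedEdge v)
  matchedEdge-incident v = proj₁ (proj₂ (proj₂ (proj₂ pm v)))

  matchedEdge-unique : ∀ {v e} → M e ≡ true → Incident Γ v e → e ≡ matchedEdge v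
  matchedEdge-unique {v} = proj₂ (proj₂ (proj₂ (proj₂ pm v))) _

  matchedEdge-nonLoop : ∀ {e} → M e ≡ true → proj₁ (ends Γ e) ≢ proj₂ (ends Γ e)
  matchedEdge-nonLoop = proj₁ pm _

  matched-exclusive : ∀ {v e e′} → e ≢ e′ → Incident Γ v e → Incident Γ v e′ →
                      M e ≡ true → M e′ ≡ false
  matched-exclusive {e′ = e′} e≢e′ v∈e v∈e′ Me with M e′ in Me′
  ... | false = refl
  ... | true  = contradiction (trans (matchedEdge-unique Me v∈e) (sym (matchedEdge-unique Me′ v∈e′))) e≢e′

module Forest {k m : ℕ} (edge : Fin m → Fin k × Fin k) where

  private
    G : Multigraph
    G = graphOf edge

  s t : Fin m → Fin k
  s i = proj₁ (edge i)
  t i = proj₂ (edge i)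

  Step : Fin m → Fin k → Fin k → Set
  Step i u v = (s i ≡ u × t i ≡ v) ⊎ (s i ≡ v × t i ≡ u)

  step-incident : ∀ {i u v} → Step i u v → Incident G u i
  step-incident (inj₁ (refl , _)) = inj₁ refl
  step-incident (inj₂ (_ , refl)) = inj₂ refl

  step-endpoint : ∀ {i u v x} → Step i u v → Incident G x i → x ≡ u ⊎ x ≡ v
  step-endpoint (inj₁ (refl , _)) (inj₁ x≡s) = inj₁ x≡s
  step-endpoint (inj₁ (_ , refl)) (inj₂ x≡t) = inj₂ x≡t
  step-endpoint (inj₂ (refl , _)) (inj₁ x≡s) = inj₂ x≡s
  step-endpoint (inj₂ (_ , refl)) (inj₂ x≡t) = inj₁ x≡t

  step-sym : ∀ {i u v} → Step i u v → Step i v u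
  step-sym (inj₁ st) = inj₂ st
  step-sym (inj₂ ts) = inj₁ ts

  incident⇒step : ∀ {i u v} → Incident G u i → Incident G v i → u ≡ v ⊎ Step i u v
  incident⇒step (inj₁ refl) (inj₁ refl) = inj₁ refl
  incident⇒step (inj₁ refl) (inj₂ refl) = inj₂ (inj₁ (refl , refl))
  incident⇒step (inj₂ refl) (inj₁ refl) = inj₂ (inj₂ (refl , refl))
  incident⇒step (inj₂ refl) (inj₂ refl) = inj₁ refl

  step-into : ∀ {i v} → Incident G v i → ∃ λ u → Step i u v
  step-into {i} (inj₁ refl) = t i , inj₂ (refl , refl)
  step-into {i} (inj₂ refl) = s i , inj₁ (refl , refl)

  _++ʷ_ : ∀ {a b c} → Walk G a b → Walk G b c → Walk G a c
  nil           ++ʷ q = q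
  cons e v st p ++ʷ q = cons e v st (p ++ʷ q)

  walkEdges-++ʷ : ∀ {a b c} (p : Walk G a b) (q : Walk G b c) →
                  walkEdges (p ++ʷ q) ≡ walkEdges p ++ walkEdges q
  walkEdges-++ʷ nil             q = refl
  walkEdges-++ʷ (cons e v st p) q = cong (e ∷_) (walkEdges-++ʷ p q)

  module _ (acyclic : Acyclic G) where

    loopless : ∀ i → s i ≢ t i
    loopless i s≡t with () ← acyclic (s i) (cons i (s i) (inj₁ (refl , sym s≡t)) nil) ([] ∷ [])

    step-distinct : ∀ {i u v} → Step i u v → u ≢ v
    step-distinct {i} (inj₁ (refl , refl)) = loopless i
    step-distinct {i} (inj₂ (refl , refl)) = loopless i ∘ sym

    step-functional : ∀ {i u v v′} → Step i u v → Step i u v′ → v ≡ v′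
    step-functional (inj₁ (refl , refl)) (inj₁ (_ , refl))   = refl
    step-functional (inj₁ (refl , refl)) (inj₂ (_ , t≡s))    = contradiction (sym t≡s) (loopless _)
    step-functional (inj₂ (refl , refl)) (inj₁ (s≡t , _))    = contradiction s≡t (loopless _)
    step-functional (inj₂ (refl , refl)) (inj₂ (refl , _))   = refl

    private
      append-unique : ∀ {u a v w e} (r : Walk G u a) {st : Step e a v} {p : Walk G v w} →
                      Unique (walkEdges r ++ e ∷ walkEdges p) →
                      Unique (walkEdges (r ++ʷ cons e v st nil) ++ walkEdges p)
      append-unique {e = e} r {st} {p} = subst Unique (sym (begin
        walkEdges (r ++ʷ cons e _ st nil) ++ walkEdges p ≡⟨ cong (_++ walkEdges p) (walkEdges-++ʷ r _) ⟩
        (walkEdges r ++ e ∷ []) ++ walkEdges p           ≡⟨ ++-assoc (walkEdges r) (e ∷ []) (walkEdges p) ⟩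
        walkEdges r ++ e ∷ walkEdges p                   ∎))
        where open ≡-Reasoning

      append-nonempty : ∀ {u a v e} (r : Walk G u a) {st : Step e a v} →
                        walkEdges (r ++ʷ cons e v st nil) ≢ []
      append-nonempty r {st} eq
        with () ← ++-conicalʳ (walkEdges r) _ (trans (sym (walkEdges-++ʷ r (cons _ _ st nil))) eq)

      -- r is the part of the trail already walked: a return to u before j would close a cycle.
      firstReturn : ∀ {u a w j} (r : Walk G u a) (p : Walk G a w) → Unique (walkEdges r ++ walkEdges p) →
                    j ∈ walkEdges p → Incident G u j →
                    walkEdges r ≡ [] × ∃ λ es → walkEdges p ≡ j ∷ es
      firstReturn r (cons e v st p) r++p! (here refl) u∈e with step-endpoint st u∈e
      ... | inj₁ refl = acyclic _ r (unique-++⁻ˡ (walkEdges r) r++p!) , walkEdges p , refl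
      ... | inj₂ refl = contradiction (acyclic _ (r ++ʷ cons e v st nil) (unique-++⁻ˡ _ (append-unique r r++p!)))
                                      (append-nonempty r)
      firstReturn r (cons e v st p) r++p! (there j∈p) u∈j =
        contradiction (proj₁ (firstReturn (r ++ʷ cons e v st nil) p (append-unique r r++p!) j∈p u∈j))
                      (append-nonempty r)

    edgeAtStart-first : ∀ {u w j} (p : Walk G u w) → Unique (walkEdges p) → j ∈ walkEdges p →
                        Incident G u j → ∃ λ es → walkEdges p ≡ j ∷ es
    edgeAtStart-first p p! j∈p u∈j = proj₂ (firstReturn nil p p! j∈p u∈j)

  Leafless : (Fin m → Set) → Set
  Leafless P = ∀ i → P i → ∀ v → Incident G v i → ∃ λ j → j ≢ i × P j × Incident G v j

  record Trail (P : Fin m → Set) (n : ℕ) : Set where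
    constructor trail
    field
      {start end} : Fin k
      walk        : Walk G start end
      unique      : Unique (walkEdges walk)
      allP        : All P (walkEdges walk)
      length≡     : length (walkEdges walk) ≡ suc n

  module _ (acyclic : Acyclic G) {P : Fin m → Set} (leafless : Leafless P) where

    extendTrail : ∀ {n} → Trail P n → Trail P (suc n)
    extendTrail (trail (cons e v st p) p! (Pe ∷ Pp) len) =
      let j , j≢e , Pj , u∈j = leafless e Pe _ (step-incident st)
          _ , st′ = step-into u∈j
          j∉p : j ∉ walkEdges (cons e v st p)
          j∉p j∈p = j≢e (sym (∷-injectiveˡ (proj₂ (edgeAtStart-first acyclic (cons e v st p) p! j∈p u∈j))))
      in trail (cons j _ st′ (cons e v st p)) (All.¬Any⇒All¬ _ j∉p ∷ p!) (Pj ∷ Pe ∷ Pp) (cong suc len)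

    longTrail : ∀ {i} → P i → ∀ n → Trail P n
    longTrail {i} Pi zero    = trail (cons i (t i) (inj₁ (refl , refl)) nil) ([] ∷ []) (Pi ∷ []) refl
    longTrail     Pi (suc n) = extendTrail (longTrail Pi n)

    leafless⇒empty : ∀ i → ¬ P i
    leafless⇒empty i Pi = ℕ.1+n≰n (subst (_≤ m) length≡ (unique⇒length≤ unique))
      where open Trail (longTrail Pi m)

  module _ (acyclic : Acyclic G) {μ₁ μ₂ : Fin m → Bool}
           (pm₁ : IsPerfectMatching G μ₁) (pm₂ : IsPerfectMatching G μ₂) where

    private
      symmetricDifference-extends : ∀ {ν₁ ν₂} → IsPerfectMatching G ν₁ → IsPerfectMatching G ν₂ →
        ∀ {i v} → ν₁ i ≡ true → ν₂ i ≡ false → Incident G v i →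
        ∃ λ j → j ≢ i × ν₁ j ≢ ν₂ j × Incident G v j
      symmetricDifference-extends {ν₁} {ν₂} ν₁-pm ν₂-pm {i} {v} ν₁i ν₂i v∈i
        with ν₁ (matchedEdge ν₂-pm v) in ν₁j
      ... | false = matchedEdge ν₂-pm v , j≢i ,
                    (λ eq → contradiction (trans (sym ν₁j) (trans eq (matchedEdge-∈ ν₂-pm v))) λ ()) ,
                    matchedEdge-incident ν₂-pm v
        where
        j≢i : matchedEdge ν₂-pm v ≢ i
        j≢i refl = contradiction (trans (sym ν₂i) (matchedEdge-∈ ν₂-pm v)) λ ()
      ... | true  = contradiction (trans (sym ν₂i) (subst (λ j → ν₂ j ≡ true) j≡i (matchedEdge-∈ ν₂-pm v))) λ ()
        where
        j≡i : matchedEdge ν₂-pm v ≡ i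
        j≡i = trans (matchedEdge-unique ν₁-pm ν₁j (matchedEdge-incident ν₂-pm v))
                    (sym (matchedEdge-unique ν₁-pm ν₁i v∈i))

    perfectMatching-unique : ∀ i → μ₁ i ≡ μ₂ i
    perfectMatching-unique i with μ₁ i Bool.≟ μ₂ i
    ... | yes μ₁i≡μ₂i = μ₁i≡μ₂i
    ... | no  μ₁i≢μ₂i = contradiction μ₁i≢μ₂i (leafless⇒empty acyclic difference-leafless i)
      where
      difference-leafless : Leafless (λ i → μ₁ i ≢ μ₂ i)
      difference-leafless i μ₁i≢μ₂i v v∈i with μ₁ i in μ₁i | μ₂ i in μ₂i
      ... | true  | true  = contradiction refl μ₁i≢μ₂i
      ... | false | false = contradiction refl μ₁i≢μ₂i
      ... | true  | false = symmetricDifference-extends pm₁ pm₂ μ₁i μ₂i v∈i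
      ... | false | true  = let j , j≢i , μ₂j≢μ₁j , v∈j = symmetricDifference-extends pm₂ pm₁ μ₂i μ₁i v∈i
                            in j , j≢i , μ₂j≢μ₁j ∘ sym , v∈j

module Action {k : ℕ} (s t : Fin k) (s≢t : s ≢ t) where

  act-source : ∀ {l} (w : Vec (Fin k) l) → act (s , t) (s ∷ w) ≡ t ∷ act (s , t) w
  act-source w with s ≟ s
  ... | yes _  = refl
  ... | no s≢s = contradiction refl s≢s

  act-target : ∀ {l} (w : Vec (Fin k) l) → act (s , t) (t ∷ w) ≡ s ∷ w
  act-target w with t ≟ s | t ≟ t
  ... | yes t≡s | _      = contradiction (sym t≡s) s≢t
  ... | no _    | yes _  = refl
  ... | no _    | no t≢t = contradiction refl t≢t

  act-other : ∀ {l z} (w : Vec (Fin k) l) → z ≢ s → z ≢ t → act (s , t) (z ∷ w) ≡ z ∷ w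
  act-other {z = z} w z≢s z≢t with z ≟ s | z ≟ t
  ... | yes z≡s | _       = contradiction z≡s z≢s
  ... | no _    | yes z≡t = contradiction z≡t z≢t
  ... | no _    | no _    = refl

module Orbits {k : ℕ} (s t : Fin k) (s≢t : s ≢ t) where
  open Words k
  open Action s t s≢t public
  open Action t s (s≢t ∘ sym) public using ()
    renaming (act-source to act⁻¹-target; act-target to act⁻¹-source; act-other to act⁻¹-other)

  Word : ℕ → Set
  Word = Vec (Fin k)

  α : ∀ {l} → Word l → Word l
  α = act (s , t)

  α⁻¹ : ∀ {l} → Word l → Word l
  α⁻¹ = act (t , s)

  data Letter (z : Fin k) : Set where
    source : z ≡ s → Letter z
    target : z ≡ t → Letter z
    other  : z ≢ s → z ≢ t → Letter z

  letter : ∀ z → Letter z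
  letter z with z ≟ s | z ≟ t
  ... | yes z≡s | _       = source z≡s
  ... | no _    | yes z≡t = target z≡t
  ... | no z≢s  | no z≢t  = other z≢s z≢t

  α-α⁻¹ : ∀ {l} (w : Word l) → α (α⁻¹ w) ≡ w
  α-α⁻¹ []      = refl
  α-α⁻¹ (z ∷ w) with letter z
  ... | source refl    = trans (cong α (act⁻¹-source w)) (act-target w)
  ... | target refl    = trans (cong α (act⁻¹-target w)) (trans (act-source (α⁻¹ w)) (cong (t ∷_) (α-α⁻¹ w)))
  ... | other z≢s z≢t = trans (cong α (act⁻¹-other w z≢t z≢s)) (act-other w z≢s z≢t)

  α⁻¹-α : ∀ {l} (w : Word l) → α⁻¹ (α w) ≡ w
  α⁻¹-α []      = refl
  α⁻¹-α (z ∷ w) with letter z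
  ... | source refl    = trans (cong α⁻¹ (act-source w)) (trans (act⁻¹-target (α w)) (cong (s ∷_) (α⁻¹-α w)))
  ... | target refl    = trans (cong α⁻¹ (act-target w)) (act⁻¹-source w)
  ... | other z≢s z≢t = trans (cong α⁻¹ (act-other w z≢s z≢t)) (act⁻¹-other w z≢t z≢s)

  -- α acts as an odometer on the longest prefix over {s , t} and fixes the rest of the word;
  -- ρ replaces that prefix by s's, which picks one word in each α-orbit.
  ρ : ∀ {l} → Word l → Word l
  ρ []      = []
  ρ (z ∷ w) with z ≟ s | z ≟ t
  ... | no _ | no _ = z ∷ w
  ... | _    | _    = s ∷ ρ w

  ρ-source : ∀ {l} (w : Word l) → ρ (s ∷ w) ≡ s ∷ ρ w
  ρ-source w with s ≟ s
  ... | yes _  = refl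
  ... | no s≢s = contradiction refl s≢s

  ρ-target : ∀ {l} (w : Word l) → ρ (t ∷ w) ≡ s ∷ ρ w
  ρ-target w with t ≟ s | t ≟ t
  ... | yes _ | _      = refl
  ... | no _  | yes _  = refl
  ... | no _  | no t≢t = contradiction refl t≢t

  ρ-other : ∀ {l z} (w : Word l) → z ≢ s → z ≢ t → ρ (z ∷ w) ≡ z ∷ w
  ρ-other {z = z} w z≢s z≢t with z ≟ s | z ≟ t
  ... | yes z≡s | _       = contradiction z≡s z≢s
  ... | no _    | yes z≡t = contradiction z≡t z≢t
  ... | no _    | no _    = refl

  ρ-α : ∀ {l} (w : Word l) → ρ (α w) ≡ ρ w
  ρ-α []      = refl
  ρ-α (z ∷ w) with letter z
  ... | source refl    = begin
    ρ (α (s ∷ w)) ≡⟨ cong ρ (act-source w) ⟩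
    ρ (t ∷ α w)   ≡⟨ ρ-target (α w) ⟩
    s ∷ ρ (α w)   ≡⟨ cong (s ∷_) (ρ-α w) ⟩
    s ∷ ρ w       ≡⟨ sym (ρ-source w) ⟩
    ρ (s ∷ w)     ∎
    where open ≡-Reasoning
  ... | target refl    = trans (cong ρ (act-target w)) (trans (ρ-source w) (sym (ρ-target w)))
  ... | other z≢s z≢t = cong ρ (act-other w z≢s z≢t)

  ρ-α⁻¹ : ∀ {l} (w : Word l) → ρ (α⁻¹ w) ≡ ρ w
  ρ-α⁻¹ w = trans (sym (ρ-α (α⁻¹ w))) (cong ρ (α-α⁻¹ w))

  invariant-∷source : ∀ {A : Set} {l} (g : Word (suc l) → A) → (∀ w → g (α w) ≡ g w) →
                     ∀ w → g (s ∷ α w) ≡ g (s ∷ w)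
  invariant-∷source g g-inv w = begin
    g (s ∷ α w)     ≡⟨ cong g (sym (act-target (α w))) ⟩
    g (α (t ∷ α w)) ≡⟨ g-inv (t ∷ α w) ⟩
    g (t ∷ α w)     ≡⟨ cong g (sym (act-source w)) ⟩
    g (α (s ∷ w))   ≡⟨ g-inv (s ∷ w) ⟩
    g (s ∷ w)       ∎
    where open ≡-Reasoning

  invariant⇒ρ-invariant : ∀ {A : Set} {l} (g : Word l → A) → (∀ w → g (α w) ≡ g w) →
                          ∀ w → g (ρ w) ≡ g w
  invariant⇒ρ-invariant g g-inv []      = refl
  invariant⇒ρ-invariant g g-inv (z ∷ w) with letter z
  ... | source refl    = trans (cong g (ρ-source w))
                               (invariant⇒ρ-invariant (g ∘ (s ∷_)) (invariant-∷source g g-inv) w)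
  ... | target refl    = begin
    g (ρ (t ∷ w)) ≡⟨ cong g (ρ-target w) ⟩
    g (s ∷ ρ w)   ≡⟨ invariant⇒ρ-invariant (g ∘ (s ∷_)) (invariant-∷source g g-inv) w ⟩
    g (s ∷ w)     ≡⟨ cong g (sym (act-target w)) ⟩
    g (α (t ∷ w)) ≡⟨ g-inv (t ∷ w) ⟩
    g (t ∷ w)     ∎
    where open ≡-Reasoning
  ... | other z≢s z≢t = cong g (ρ-other w z≢s z≢t)

  other? : ∀ z → Dec (z ≢ s × z ≢ t)
  other? z = ¬? (z ≟ s) ×-dec ¬? (z ≟ t)

  others : List (Fin k)
  others = filter other? (allFin k)

  ∈-others : ∀ {z} → z ≢ s → z ≢ t → z ∈ others
  ∈-others z≢s z≢t = ∈-filter⁺ other? (∈-allFin _) (z≢s , z≢t)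

  others-≢ : ∀ {z} → z ∈ others → z ≢ s × z ≢ t
  others-≢ = proj₂ ∘ ∈-filter⁻ other? {xs = allFin k}

  others-unique : Unique others
  others-unique = Unique.filter⁺ _ (Unique.allFin⁺ k)

  length-others : 2 + length others ≡ k
  length-others = unique∧complete⇒length≡ st-others-unique complete
    where
    st-others-unique : Unique (s ∷ t ∷ others)
    st-others-unique = (s≢t ∷ All.tabulate (λ z∈ → proj₁ (others-≢ z∈) ∘ sym))
                     ∷ All.tabulate (λ z∈ → proj₂ (others-≢ z∈) ∘ sym)
                     ∷ others-unique
    complete : ∀ z → z ∈ s ∷ t ∷ others
    complete z with letter z
    ... | source refl    = here refl
    ... | target refl    = there (here refl)
    ... | other z≢s z≢t = there (there (∈-others z≢s z≢t))

  -- the fixed points of ρ, one for each α-orbit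
  reps : ∀ l → List (Word l)
  reps zero    = [] ∷ []
  reps (suc l) = map (s ∷_) (reps l) ++ cartesianProductWith _∷_ others (words l)

  reps-unique : ∀ l → Unique (reps l)
  reps-unique zero    = [] ∷ []
  reps-unique (suc l) = Unique.++⁺ (Unique.map⁺ VecP.∷-injectiveʳ (reps-unique l))
    (Unique.cartesianProductWith⁺ _∷_ VecP.∷-injective others-unique (words-unique l)) disjoint
    where
    disjoint : Disjoint (map (s ∷_) (reps l)) (cartesianProductWith _∷_ others (words l))
    disjoint (v∈map , v∈prod)
      with _ , _ , refl ← ∈-map⁻ (s ∷_) v∈map
         | _ , _ , z∈others , _ , eq ← ∈-cartesianProductWith⁻ _∷_ others (words l) v∈prod
      = proj₁ (others-≢ z∈others) (sym (VecP.∷-injectiveˡ eq))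

  ρ-fixed : ∀ {l r} → r ∈ reps l → ρ r ≡ r
  ρ-fixed {zero}  (here refl) = refl
  ρ-fixed {suc l} r∈ with ∈-++⁻ (map (s ∷_) (reps l)) r∈
  ... | inj₁ r∈map with r′ , r′∈ , refl ← ∈-map⁻ (s ∷_) r∈map =
    trans (ρ-source r′) (cong (s ∷_) (ρ-fixed r′∈))
  ... | inj₂ r∈prod with _ , w , z∈others , _ , refl ← ∈-cartesianProductWith⁻ _∷_ others (words l) r∈prod =
    uncurry (ρ-other w) (others-≢ z∈others)

  ρ∈reps : ∀ {l} (w : Word l) → ρ w ∈ reps l
  ρ∈reps []      = here refl
  ρ∈reps {suc l} (z ∷ w) with letter z
  ... | source refl    = subst (_∈ reps (suc l)) (sym (ρ-source w)) (∈-++⁺ˡ (∈-map⁺ (s ∷_) (ρ∈reps w)))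
  ... | target refl    = subst (_∈ reps (suc l)) (sym (ρ-target w)) (∈-++⁺ˡ (∈-map⁺ (s ∷_) (ρ∈reps w)))
  ... | other z≢s z≢t = subst (_∈ reps (suc l)) (sym (ρ-other w z≢s z≢t))
    (∈-++⁺ʳ (map (s ∷_) (reps l)) (∈-cartesianProductWith⁺ _∷_ (∈-others z≢s z≢t) (∈-words w)))

  length-reps-suc : ∀ l → length (reps (suc l)) + 2 * k ^ l ≡ length (reps l) + k * k ^ l
  length-reps-suc l = begin
    length (reps (suc l)) + 2 * K   ≡⟨ cong (_+ 2 * K) length-reps-step ⟩
    L + length others * K + 2 * K   ≡⟨ ℕ.+-assoc L _ (2 * K) ⟩
    L + (length others * K + 2 * K) ≡⟨ cong (L +_) (sym (ℕ.*-distribʳ-+ K (length others) 2)) ⟩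
    L + (length others + 2) * K     ≡⟨ cong (λ n → L + n * K) (trans (ℕ.+-comm (length others) 2) length-others) ⟩
    L + k * K                       ∎
    where
    open ≡-Reasoning
    K L : ℕ
    K = k ^ l
    L = length (reps l)
    length-reps-step : length (reps (suc l)) ≡ L + length others * K
    length-reps-step = begin
      length (reps (suc l))
        ≡⟨ length-++ (map (s ∷_) (reps l)) ⟩
      length (map (s ∷_) (reps l)) + length (cartesianProductWith _∷_ others (words l))
        ≡⟨ cong₂ _+_ (length-map (s ∷_) (reps l)) (length-cartesianProductWith _∷_ others (words l)) ⟩
      L + length others * length (words l)
        ≡⟨ cong (λ n → L + length others * n) (length-words l) ⟩
      L + length others * K
        ∎

module SchreierGraph {k m : ℕ} (edge : Fin m → Fin k × Fin k) (acyclic : Acyclic (graphOf edge)) (l : ℕ) where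
  open Forest edge
  open Words k using (word↔Fin)

  G Γ : Multigraph
  G = graphOf edge
  Γ = Schreier edge (suc l)

  Vertex : Set
  Vertex = Vec (Fin k) (suc l)

  module Orbit (i : Fin m) = Orbits (s i) (t i) (loopless acyclic i)

  open Orbit using (α; α⁻¹; letter; source; target; other)

  ≟-edge : DecidableEquality (E Γ)
  ≟-edge = ProdP.≡-dec (VecP.≡-dec _≟_) _≟_

  step-α : ∀ {i} (u : Vertex) → Incident G (head u) i → Step i (head u) (head (α i u))
  step-α {i} (_ ∷ w) (inj₁ refl) = inj₁ (refl , cong head (sym (Orbit.act-source i w)))
  step-α {i} (_ ∷ w) (inj₂ refl) = inj₂ (cong head (sym (Orbit.act-target i w)) , refl)

  incident⇒nonLoop : ∀ {i} (u : Vertex) → Incident G (head u) i → u ≢ α i u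
  incident⇒nonLoop u u∈i u≡αu = step-distinct acyclic (step-α u u∈i) (cong head u≡αu)

  nonLoop⇒incident : ∀ {i} (u : Vertex) → u ≢ α i u → Incident G (head u) i
  nonLoop⇒incident {i} (z ∷ w) u≢αu with letter i z
  ... | source z≡s     = inj₁ z≡s
  ... | target z≡t     = inj₂ z≡t
  ... | other z≢s z≢t = contradiction (sym (Orbit.act-other i w z≢s z≢t)) u≢αu

  incident-head : ∀ {i x} (u : Vertex) → Incident G (head u) i → Incident Γ x (u , i) → Incident G (head x) i
  incident-head u u∈i (inj₁ refl) = u∈i
  incident-head u u∈i (inj₂ refl) = step-incident (step-sym (step-α u u∈i))

  incident-edge : ∀ {i x u} → Incident Γ x (u , i) → u ≡ x ⊎ u ≡ α⁻¹ i x
  incident-edge             (inj₁ refl) = inj₁ refl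
  incident-edge {i} {u = u} (inj₂ refl) = inj₂ (sym (Orbit.α⁻¹-α i u))

  endpoints-determined-by-head : ∀ {i u x y} → u ≢ α i u →
    Incident Γ x (u , i) → Incident Γ y (u , i) → head x ≡ head y → x ≡ y
  endpoints-determined-by-head _ (inj₁ refl) (inj₁ refl) _ = refl
  endpoints-determined-by-head _ (inj₂ refl) (inj₂ refl) _ = refl
  endpoints-determined-by-head {u = u} u≢αu (inj₁ refl) (inj₂ refl) hx≡hy =
    contradiction hx≡hy (step-distinct acyclic (step-α u (nonLoop⇒incident u u≢αu)))
  endpoints-determined-by-head {u = u} u≢αu (inj₂ refl) (inj₁ refl) hx≡hy =
    contradiction (sym hx≡hy) (step-distinct acyclic (step-α u (nonLoop⇒incident u u≢αu)))

  α⁻¹-incident : ∀ i x → Incident Γ x (α⁻¹ i x , i)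
  α⁻¹-incident i x = inj₂ (sym (Orbit.α-α⁻¹ i x))

  length-reps-indep : ∀ i j l′ → length (Orbit.reps i l′) ≡ length (Orbit.reps j l′)
  length-reps-indep i j zero     = refl
  length-reps-indep i j (suc l′) = ℕ.+-cancelʳ-≡ (2 * k ^ l′) _ _ (begin
    length (Orbit.reps i (suc l′)) + 2 * k ^ l′ ≡⟨ Orbit.length-reps-suc i l′ ⟩
    length (Orbit.reps i l′) + k * k ^ l′       ≡⟨ cong (_+ k * k ^ l′) (length-reps-indep i j l′) ⟩
    length (Orbit.reps j l′) + k * k ^ l′       ≡⟨ sym (Orbit.length-reps-suc j l′) ⟩
    length (Orbit.reps j (suc l′)) + 2 * k ^ l′ ∎)
    where open ≡-Reasoning

  α⁻¹-edge-≢ : ∀ {i} x → Incident G (head x) i → (x , i) ≢ (α⁻¹ i x , i)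
  α⁻¹-edge-≢ {i} x x∈i eq =
    incident⇒nonLoop x x∈i (sym (trans (cong (α i ∘ proj₁) eq) (Orbit.α-α⁻¹ i x)))

  module Labels {M : E Γ → Bool} (pm : IsPerfectMatching Γ M) where

    label : Vertex → Fin m
    label x = proj₂ (matchedEdge pm x)

    private
      src : Vertex → Vertex
      src x = proj₁ (matchedEdge pm x)

    partner : Vertex → Vertex
    partner x with matchedEdge-incident pm x
    ... | inj₁ _ = α (label x) (src x)
    ... | inj₂ _ = src x

    partner-incident : ∀ x → Incident Γ (partner x) (matchedEdge pm x)
    partner-incident x with matchedEdge-incident pm x
    ... | inj₁ _ = inj₂ refl
    ... | inj₂ _ = inj₁ refl

    matchedEdge-partner : ∀ x → matchedEdge pm (partner x) ≡ matchedEdge pm x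
    matchedEdge-partner x = sym (matchedEdge-unique pm (matchedEdge-∈ pm x) (partner-incident x))

    label-partner : ∀ x → label (partner x) ≡ label x
    label-partner x = cong proj₂ (matchedEdge-partner x)

    private
      matched-step : ∀ x → Step (label x) (head (src x)) (head (α (label x) (src x)))
      matched-step x = step-α (src x) (nonLoop⇒incident (src x) (matchedEdge-nonLoop pm (matchedEdge-∈ pm x)))

    partner-step : ∀ x → Step (label x) (head x) (head (partner x))
    partner-step x with matchedEdge-incident pm x
    ... | inj₁ x≡u  = subst (λ y → Step (label x) (head y) (head (α (label x) (src x)))) (sym x≡u) (matched-step x)
    ... | inj₂ x≡αu = subst (λ y → Step (label x) (head y) (head (src x))) (sym x≡αu) (step-sym (matched-step x))

    label-incident : ∀ x → Incident G (head x) (label x)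
    label-incident x = step-incident (partner-step x)

    partner-injective : ∀ {x y} → head x ≡ head y → partner x ≡ partner y → x ≡ y
    partner-injective {x} {y} hx≡hy px≡py =
      endpoints-determined-by-head (matchedEdge-nonLoop pm (matchedEdge-∈ pm y))
        (subst (Incident Γ x) e≡ (matchedEdge-incident pm x)) (matchedEdge-incident pm y) hx≡hy
      where
      e≡ : matchedEdge pm x ≡ matchedEdge pm y
      e≡ = trans (sym (matchedEdge-partner x)) (trans (cong (matchedEdge pm) px≡py) (matchedEdge-partner y))

    private
      head-tail : ∀ (x : Vertex) {a} → head x ≡ a → x ≡ a ∷ tail x
      head-tail (_ ∷ _) refl = refl

    partner-head : ∀ {i a b} w → Step i a b → label (a ∷ w) ≡ i → head (partner (a ∷ w)) ≡ b
    partner-head {a = a} w st refl = step-functional acyclic (partner-step (a ∷ w)) st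

    label-transfer : ∀ {i a b} w → Step i a b → label (a ∷ w) ≡ i → ∃ λ w′ → label (b ∷ w′) ≡ i
    label-transfer {a = a} w st aw≡i =
      tail (partner (a ∷ w)) ,
      trans (cong label (sym (head-tail (partner (a ∷ w)) (partner-head w st aw≡i))))
            (trans (label-partner (a ∷ w)) aw≡i)

    -- The partners of the copy of b are pairwise distinct and lie in the copy of a, so they fill it.
    label-fullTransfer : ∀ {i a b} → Step i a b → (∀ w → label (b ∷ w) ≡ i) → ∀ w → label (a ∷ w) ≡ i
    label-fullTransfer {i} {a} {b} st all-i y =
      let w , φw≡y = finite-injective⇒surjective (word↔Fin l) φ φ-injective y
      in begin
        label (a ∷ y)           ≡⟨ cong (λ y → label (a ∷ y)) (sym φw≡y) ⟩
        label (a ∷ φ w)         ≡⟨ cong label (sym (partner-copy w)) ⟩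
        label (partner (b ∷ w)) ≡⟨ label-partner (b ∷ w) ⟩
        label (b ∷ w)           ≡⟨ all-i w ⟩
        i                       ∎
      where
      open ≡-Reasoning
      φ : Vec (Fin k) l → Vec (Fin k) l
      φ w = tail (partner (b ∷ w))
      partner-copy : ∀ w → partner (b ∷ w) ≡ a ∷ φ w
      partner-copy w = head-tail (partner (b ∷ w)) (partner-head w (step-sym st) (all-i w))
      φ-injective : Injective _≡_ _≡_ φ
      φ-injective {w} {w′} φw≡φw′ = VecP.∷-injectiveʳ (partner-injective refl
        (trans (partner-copy w) (trans (cong (a ∷_) φw≡φw′) (sym (partner-copy w′)))))

    label-transfer≢ : ∀ {i a b} → Step i a b → (∃ λ w → label (a ∷ w) ≢ i) →
                      ∃ λ w → label (b ∷ w) ≢ i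
    label-transfer≢ {i} {a} {b} st (w , aw≢i) =
      finite-¬∀⇒∃¬ (word↔Fin l) (λ w → label (b ∷ w) ≟ i)
                   (λ all-i → aw≢i (label-fullTransfer st all-i w))

    private
      Mixed : Fin m → Set
      Mixed i = (∃ λ x → label x ≡ i) × (∃ λ y → Incident G (head y) i × label y ≢ i)

      inCopy : ∀ {i v} x → label x ≡ i → Incident G v i → ∃ λ w → label (v ∷ w) ≡ i
      inCopy (z ∷ w) refl v∈i with incident⇒step (label-incident (z ∷ w)) v∈i
      ... | inj₁ refl = w , refl
      ... | inj₂ st   = label-transfer w st refl

      notInCopy : ∀ {i v} y → Incident G (head y) i → label y ≢ i → Incident G v i →
                  ∃ λ w → label (v ∷ w) ≢ i
      notInCopy (z ∷ w) z∈i zw≢i v∈i with incident⇒step z∈i v∈i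
      ... | inj₁ refl = w , zw≢i
      ... | inj₂ st   = label-transfer≢ st (w , zw≢i)

      mixed-leafless : Leafless Mixed
      mixed-leafless i ((x , x≡i) , (y , y∈i , y≢i)) v v∈i =
        let w  , vw≢i  = notInCopy y y∈i y≢i v∈i
            w′ , vw′≡i = inCopy x x≡i v∈i
        in label (v ∷ w) , vw≢i ,
           ((v ∷ w , refl) , (v ∷ w′ , label-incident (v ∷ w) , λ eq → vw≢i (trans (sym eq) vw′≡i))) ,
           label-incident (v ∷ w)

    label-constant : ∀ z w w′ → label (z ∷ w) ≡ label (z ∷ w′)
    label-constant z w w′ with label (z ∷ w′) ≟ label (z ∷ w)
    ... | yes eq = sym eq
    ... | no neq = contradiction ((z ∷ w , refl) , (z ∷ w′ , label-incident (z ∷ w) , neq))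
                                 (leafless⇒empty acyclic mixed-leafless (label (z ∷ w)))

    copyLabel : Fin k → Fin m
    copyLabel v = label (v ∷ Vec.replicate l v)

    label≡copyLabel : ∀ x → label x ≡ copyLabel (head x)
    label≡copyLabel (z ∷ w) = label-constant z w _

    copyLabel-incident : ∀ v → Incident G v (copyLabel v)
    copyLabel-incident v = label-incident (v ∷ Vec.replicate l v)

    copyLabel-transfer : ∀ {i a b} → Incident G a i → Incident G b i → copyLabel a ≡ i → copyLabel b ≡ i
    copyLabel-transfer a∈i b∈i a≡i with incident⇒step a∈i b∈i
    ... | inj₁ refl = a≡i
    ... | inj₂ st   = let w′ , bw′≡i = label-transfer _ st a≡i
                      in trans (sym (label≡copyLabel (_ ∷ w′))) bw′≡i

    inducedMatching : Fin m → Bool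
    inducedMatching i = does (copyLabel (s i) ≟ i)

    inducedMatching-copyLabel : ∀ v → inducedMatching (copyLabel v) ≡ true
    inducedMatching-copyLabel v with copyLabel (s (copyLabel v)) ≟ copyLabel v
    ... | yes _ = refl
    ... | no ne = contradiction (copyLabel-transfer (copyLabel-incident v) (inj₁ refl) refl) ne

    inducedMatching-pm : IsPerfectMatching G inducedMatching
    inducedMatching-pm = (λ i _ → loopless acyclic i) , λ v →
      copyLabel v , inducedMatching-copyLabel v , copyLabel-incident v , λ j chosen v∈j →
        sym (copyLabel-transfer (inj₁ refl) v∈j (inducedMatching-source chosen))
      where
      inducedMatching-source : ∀ {j} → inducedMatching j ≡ true → copyLabel (s j) ≡ j
      inducedMatching-source {j} chosen with copyLabel (s j) ≟ j
      inducedMatching-source refl | yes eq = eq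

    label-forced : ∀ {μ} (μ-pm : IsPerfectMatching G μ) x → label x ≡ matchedEdge μ-pm (head x)
    label-forced {μ} μ-pm x =
      trans (label≡copyLabel x) (matchedEdge-unique μ-pm μ-copyLabel (copyLabel-incident (head x)))
      where
      μ-copyLabel : μ (copyLabel (head x)) ≡ true
      μ-copyLabel = trans (sym (perfectMatching-unique acyclic inducedMatching-pm μ-pm (copyLabel (head x))))
                          (inducedMatching-copyLabel (head x))

  module Alternation {μ : Fin m → Bool} (μ-pm : IsPerfectMatching G μ) where

    record Alternating (M : E Γ → Bool) : Set where
      field
        support   : ∀ {u i} → M (u , i) ≡ true → μ i ≡ true × Incident G (head u) i
        alternate : ∀ {i} x → μ i ≡ true → Incident G (head x) i → M (x , i) ≡ not (M (α⁻¹ i x , i))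

    module _ {M : E Γ → Bool} (alt : Alternating M) where
      open Alternating alt

      private
        matchedEdgesAt : ∀ {x u j} → M (u , j) ≡ true → Incident Γ x (u , j) →
                  let i = matchedEdge μ-pm (head x) in (u , j) ≡ (x , i) ⊎ (u , j) ≡ (α⁻¹ i x , i)
        matchedEdgesAt {x} {u} Muj x∈e with support Muj
        ... | μj , u∈j with matchedEdge-unique μ-pm μj (incident-head u u∈j x∈e)
        ... | refl with incident-edge x∈e
        ...   | inj₁ refl = inj₁ refl
        ...   | inj₂ refl = inj₂ refl

        alternate-flip : ∀ x → let i = matchedEdge μ-pm (head x) in M (α⁻¹ i x , i) ≡ not (M (x , i))
        alternate-flip x = trans (sym (not-involutive _)) (cong not (sym
          (alternate x (matchedEdge-∈ μ-pm (head x)) (matchedEdge-incident μ-pm (head x)))))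

      alternating⇒pm : IsPerfectMatching Γ M
      alternating⇒pm = (λ (u , i) Me → incident⇒nonLoop u (proj₂ (support Me))) , cover
        where
        cover : ∀ x → Σ (E Γ) λ e → (M e ≡ true) × Incident Γ x e ×
                                    (∀ e′ → M e′ ≡ true → Incident Γ x e′ → e′ ≡ e)
        cover x with M (x , matchedEdge μ-pm (head x)) in Mx
        ... | true  = (x , _) , Mx , inj₁ refl , λ _ Me′ x∈e′ → case matchedEdgesAt Me′ x∈e′ of λ where
            (inj₁ e′≡e) → e′≡e
            (inj₂ refl) → contradiction (trans (sym Me′) (trans (alternate-flip x) (cong not Mx))) λ ()
        ... | false = (α⁻¹ _ x , _) , trans (alternate-flip x) (cong not Mx) , α⁻¹-incident _ x ,
                      λ _ Me′ x∈e′ → case matchedEdgesAt Me′ x∈e′ of λ where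
            (inj₁ refl) → contradiction (trans (sym Me′) Mx) λ ()
            (inj₂ e′≡e) → e′≡e

    pm⇒alternating : ∀ {M} → IsPerfectMatching Γ M → Alternating M
    pm⇒alternating {M} pm = record { support = support ; alternate = alternate }
      where
      open Labels pm

      support : ∀ {u i} → M (u , i) ≡ true → μ i ≡ true × Incident G (head u) i
      support {u} Mui with trans (cong proj₂ (matchedEdge-unique pm Mui (inj₁ refl))) (label-forced μ-pm u)
      ... | refl = matchedEdge-∈ μ-pm (head u) , matchedEdge-incident μ-pm (head u)

      alternate : ∀ {i} x → μ i ≡ true → Incident G (head x) i → M (x , i) ≡ not (M (α⁻¹ i x , i))
      alternate {i} x μi x∈i with trans (matchedEdge-unique μ-pm μi x∈i) (sym (label-forced μ-pm x))
      ... | refl with incident-edge (matchedEdge-incident pm x)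
      ...   | inj₁ src≡x = trans Mx≡true (cong not (sym
                (matched-exclusive pm (α⁻¹-edge-≢ x x∈i) (inj₁ refl) (α⁻¹-incident i x) Mx≡true)))
        where
        Mx≡true : M (x , i) ≡ true
        Mx≡true = subst (λ u → M (u , i) ≡ true) src≡x (matchedEdge-∈ pm x)
      ...   | inj₂ src≡α⁻¹x =
                trans (matched-exclusive pm (α⁻¹-edge-≢ x x∈i ∘ sym) (α⁻¹-incident i x) (inj₁ refl) Mα⁻¹x≡true)
                                    (cong not (sym Mα⁻¹x≡true))
        where
        Mα⁻¹x≡true : M (α⁻¹ i x , i) ≡ true
        Mα⁻¹x≡true = subst (λ u → M (u , i) ≡ true) src≡α⁻¹x (matchedEdge-∈ pm x)

    -- For each edge i of μ and each α-orbit (represented via ρ), h picks one of the two perfect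
    -- matchings of the corresponding cycle of i-labelled edges.
    decode : (E Γ → Bool) → E Γ → Bool
    decode h (z ∷ w , i) with μ i | z ≟ s i | z ≟ t i
    ... | true | yes _ | _     = h (s i ∷ Orbit.ρ i w , i)
    ... | true | no _  | yes _ = not (h (s i ∷ Orbit.ρ i w , i))
    ... | _    | _     | _     = false

    decode-source : ∀ h {i} w → μ i ≡ true → decode h (s i ∷ w , i) ≡ h (s i ∷ Orbit.ρ i w , i)
    decode-source h {i} w μi with μ i | s i ≟ s i | s i ≟ t i
    ... | true  | yes _  | _ = refl
    ... | true  | no s≢s | _ = contradiction refl s≢s
    ... | false | _      | _ = contradiction μi λ ()

    decode-target : ∀ h {i} w → μ i ≡ true → decode h (t i ∷ w , i) ≡ not (h (s i ∷ Orbit.ρ i w , i))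
    decode-target h {i} w μi with μ i | t i ≟ s i | t i ≟ t i
    ... | true  | yes t≡s | _      = contradiction (sym t≡s) (loopless acyclic i)
    ... | true  | no _    | yes _  = refl
    ... | true  | no _    | no t≢t = contradiction refl t≢t
    ... | false | _       | _      = contradiction μi λ ()

    decode-support : ∀ h {i} (u : Vertex) → decode h (u , i) ≡ true → μ i ≡ true × Incident G (head u) i
    decode-support h {i} (z ∷ w) Du with μ i | z ≟ s i | z ≟ t i
    ... | true | yes z≡s | _       = refl , inj₁ z≡s
    ... | true | no _    | yes z≡t = refl , inj₂ z≡t

    decode-alternating : ∀ h → Alternating (decode h)
    decode-alternating h = record { support = λ {u} → decode-support h u ; alternate = alternate }
      where
      alternate : ∀ {i} x → μ i ≡ true → Incident G (head x) i →
                  decode h (x , i) ≡ not (decode h (α⁻¹ i x , i))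
      alternate {i} (_ ∷ w) μi (inj₁ refl) = begin
        decode h (s i ∷ w , i)                ≡⟨ decode-source h w μi ⟩
        h (s i ∷ Orbit.ρ i w , i)             ≡⟨ sym (not-involutive _) ⟩
        not (not (h (s i ∷ Orbit.ρ i w , i))) ≡⟨ cong not (sym (decode-target h w μi)) ⟩
        not (decode h (t i ∷ w , i))          ≡⟨ cong (λ y → not (decode h (y , i))) (sym (Orbit.act⁻¹-source i w)) ⟩
        not (decode h (α⁻¹ i (s i ∷ w) , i))  ∎
        where open ≡-Reasoning
      alternate {i} (_ ∷ w) μi (inj₂ refl) = begin
        decode h (t i ∷ w , i)                  ≡⟨ decode-target h w μi ⟩
        not (h (s i ∷ Orbit.ρ i w , i))         ≡⟨ cong (λ y → not (h (s i ∷ y , i))) (sym (Orbit.ρ-α⁻¹ i w)) ⟩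
        not (h (s i ∷ Orbit.ρ i (α⁻¹ i w) , i)) ≡⟨ cong not (sym (decode-source h (α⁻¹ i w) μi)) ⟩
        not (decode h (s i ∷ α⁻¹ i w , i))      ≡⟨ cong (λ y → not (decode h (y , i))) (sym (Orbit.act⁻¹-target i w)) ⟩
        not (decode h (α⁻¹ i (t i ∷ w) , i))    ∎
        where open ≡-Reasoning

    module _ {M : E Γ → Bool} (alt : Alternating M) where
      open Alternating alt

      private
        alternate-target : ∀ {i} w → μ i ≡ true → M (t i ∷ w , i) ≡ not (M (s i ∷ α⁻¹ i w , i))
        alternate-target {i} w μi = trans (alternate (t i ∷ w) μi (inj₂ refl))
                                          (cong (λ y → not (M (y , i))) (Orbit.act⁻¹-target i w))

        source-invariant : ∀ {i} → μ i ≡ true → ∀ w → M (s i ∷ α i w , i) ≡ M (s i ∷ w , i)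
        source-invariant {i} μi w = begin
          M (s i ∷ α i w , i)                     ≡⟨ alternate (s i ∷ α i w) μi (inj₁ refl) ⟩
          not (M (α⁻¹ i (s i ∷ α i w) , i))       ≡⟨ cong (λ y → not (M (y , i))) (Orbit.act⁻¹-source i (α i w)) ⟩
          not (M (t i ∷ α i w , i))               ≡⟨ cong not (alternate-target (α i w) μi) ⟩
          not (not (M (s i ∷ α⁻¹ i (α i w) , i))) ≡⟨ not-involutive _ ⟩
          M (s i ∷ α⁻¹ i (α i w) , i)             ≡⟨ cong (λ y → M (s i ∷ y , i)) (Orbit.α⁻¹-α i w) ⟩
          M (s i ∷ w , i)                         ∎
          where open ≡-Reasoning

        source-ρ : ∀ {i} → μ i ≡ true → ∀ w → M (s i ∷ Orbit.ρ i w , i) ≡ M (s i ∷ w , i)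
        source-ρ {i} μi = Orbit.invariant⇒ρ-invariant i (λ w → M (s i ∷ w , i)) (source-invariant μi)

        unmatched : ∀ {u i} → ¬ (μ i ≡ true × Incident G (head u) i) → M (u , i) ≡ decode M (u , i)
        unmatched {u} ¬P = trans (¬-not (¬P ∘ support)) (sym (¬-not (¬P ∘ decode-support M u)))

      alternating⇒decode-fixed : ∀ e → M e ≡ decode M e
      alternating⇒decode-fixed (u , i) with μ i Bool.≟ true | head u ≟ s i ⊎-dec head u ≟ t i
      ... | no ¬μi | _       = unmatched (¬μi ∘ proj₁)
      ... | yes _  | no u∉i  = unmatched (u∉i ∘ proj₂)
      ... | yes μi | yes u∈i = matched u u∈i
        where
        matched : ∀ u → Incident G (head u) i → M (u , i) ≡ decode M (u , i)
        matched (_ ∷ w) (inj₁ refl) = trans (sym (source-ρ μi w)) (sym (decode-source M w μi))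
        matched (_ ∷ w) (inj₂ refl) = begin
          M (t i ∷ w , i)                         ≡⟨ alternate-target w μi ⟩
          not (M (s i ∷ α⁻¹ i w , i))             ≡⟨ cong not (sym (source-ρ μi (α⁻¹ i w))) ⟩
          not (M (s i ∷ Orbit.ρ i (α⁻¹ i w) , i)) ≡⟨ cong (λ y → not (M (s i ∷ y , i))) (Orbit.ρ-α⁻¹ i w) ⟩
          not (M (s i ∷ Orbit.ρ i w , i))         ≡⟨ sym (decode-target M w μi) ⟩
          decode M (t i ∷ w , i)                  ∎
          where open ≡-Reasoning

    μEdges : List (Fin m)
    μEdges = filter (λ i → μ i Bool.≟ true) (allFin m)

    ∈-μEdges : ∀ {i} → μ i ≡ true → i ∈ μEdges
    ∈-μEdges μi = ∈-filter⁺ (λ i → μ i Bool.≟ true) (∈-allFin _) μi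

    μEdges-μ : ∀ {i} → i ∈ μEdges → μ i ≡ true
    μEdges-μ = proj₂ ∘ ∈-filter⁻ (λ i → μ i Bool.≟ true) {xs = allFin m}

    μEdges-unique : Unique μEdges
    μEdges-unique = Unique.filter⁺ _ (Unique.allFin⁺ m)

    private
      ∈-endpoints : ∀ {v i} → v ∈ s i ∷ t i ∷ [] → Incident G v i
      ∈-endpoints (here v≡s)         = inj₁ v≡s
      ∈-endpoints (there (here v≡t)) = inj₂ v≡t

      incident⇒∈-endpoints : ∀ {v i} → Incident G v i → v ∈ s i ∷ t i ∷ []
      incident⇒∈-endpoints (inj₁ v≡s) = here v≡s
      incident⇒∈-endpoints (inj₂ v≡t) = there (here v≡t)

    -- Handshake: the endpoints of the edges of μ list every vertex exactly once.
    length-μEdges : length μEdges * 2 ≡ k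
    length-μEdges = trans (sym (length-concatMap-const endpoints (λ _ → refl) μEdges))
                          (unique∧complete⇒length≡ endpoints-unique endpoints-complete)
      where
      endpoints : Fin m → List (Fin k)
      endpoints i = s i ∷ t i ∷ []
      endpoints-unique : Unique (concatMap endpoints μEdges)
      endpoints-unique = unique-concatMap endpoints μEdges-unique (λ i → (loopless acyclic i ∷ []) ∷ [] ∷ [])
        λ i∈ j∈ i≢j (v∈i , v∈j) → i≢j (trans (matchedEdge-unique μ-pm (μEdges-μ i∈) (∈-endpoints v∈i))
                                              (sym (matchedEdge-unique μ-pm (μEdges-μ j∈) (∈-endpoints v∈j))))
      endpoints-complete : ∀ v → v ∈ concatMap endpoints μEdges
      endpoints-complete v = ∈-concatMap⁺ endpoints (lose (∈-μEdges (matchedEdge-∈ μ-pm v))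
                                                          (incident⇒∈-endpoints (matchedEdge-incident μ-pm v)))

    repEdges : Fin m → List (E Γ)
    repEdges i = map (λ r → s i ∷ r , i) (Orbit.reps i l)

    R : List (E Γ)
    R = concatMap repEdges μEdges

    private
      repEdges-label : ∀ {i e} → e ∈ repEdges i → proj₂ e ≡ i
      repEdges-label {i} e∈ with _ , _ , refl ← ∈-map⁻ (λ r → s i ∷ r , i) e∈ = refl

    R-unique : Unique R
    R-unique = unique-concatMap repEdges μEdges-unique
      (λ i → Unique.map⁺ (VecP.∷-injectiveʳ ∘ cong proj₁) (Orbit.reps-unique i l))
      (λ _ _ i≢j (e∈i , e∈j) → i≢j (trans (sym (repEdges-label e∈i)) (repEdges-label e∈j)))

    ∈-R : ∀ {i} w → μ i ≡ true → (s i ∷ Orbit.ρ i w , i) ∈ R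
    ∈-R {i} w μi =
      ∈-concatMap⁺ repEdges (lose (∈-μEdges μi) (∈-map⁺ (λ r → s i ∷ r , i) (Orbit.ρ∈reps i w)))

    decode-on-R : ∀ h {e} → e ∈ R → decode h e ≡ h e
    decode-on-R h e∈R with find (∈-concatMap⁻ repEdges {xs = μEdges} e∈R)
    ... | i , i∈μ , e∈i with ∈-map⁻ (λ r → s i ∷ r , i) e∈i
    ...   | r , r∈ , refl = trans (decode-source h r (μEdges-μ i∈μ))
              (cong (λ y → h (s i ∷ y , i)) (Orbit.ρ-fixed i r∈))

    decode-cong : ∀ g h → BooleanFunctions.AgreeOn ≟-edge R g h → ∀ e → decode g e ≡ decode h e
    decode-cong g h g≈h (z ∷ w , i) with μ i in μi | z ≟ s i | z ≟ t i
    ... | true  | yes _ | _     = g≈h (∈-R w μi)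
    ... | true  | no _  | yes _ = cong not (g≈h (∈-R w μi))
    ... | true  | no _  | no _  = refl
    ... | false | _     | _     = refl

    numPerfectMatchings-Γ : NumPerfectMatchings Γ (2 ^ length R)
    numPerfectMatchings-Γ = numPerfectMatchings-retract Γ ≟-edge R R-unique decode
      (λ h → alternating⇒pm (decode-alternating h)) decode-on-R decode-cong
      (λ M pm → alternating⇒decode-fixed (pm⇒alternating pm))

    length-R : ∀ i₀ → length R ≡ length μEdges * length (Orbit.reps i₀ l)
    length-R i₀ = length-concatMap-const repEdges
      (λ i → trans (length-map _ (Orbit.reps i l)) (length-reps-indep i i₀ l)) μEdges

orbitCount-closed : ∀ k′ (c : ℕ → ℕ) → c 0 ≡ 1 →
  (∀ l → c (suc l) + 2 * suc k′ ^ l ≡ c l + suc k′ * suc k′ ^ l) →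
  ∀ l → k′ * c l + 2 * suc k′ ^ l ≡ suc k′ * suc k′ ^ l + 1
orbitCount-closed k′ c c0 rec zero = trans (cong (λ x → k′ * x + 2) c0) (base k′)
  where
  base : ∀ k′ → k′ * 1 + 2 ≡ suc k′ * 1 + 1
  base = solve-∀
orbitCount-closed k′ c c0 rec (suc l) = ℕ.+-cancelʳ-≡ (k′ * (2 * K) + 2 * K) _ _ (begin
  k′ * c (suc l) + 2 * (k * K) + (k′ * (2 * K) + 2 * K)
    ≡⟨ regroup₁ k′ (c (suc l)) K ⟩
  k′ * (c (suc l) + 2 * K) + 2 * (k * K) + 2 * K
    ≡⟨ cong (λ x → k′ * x + 2 * (k * K) + 2 * K) (rec l) ⟩
  k′ * (c l + k * K) + 2 * (k * K) + 2 * K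
    ≡⟨ regroup₂ k′ (c l) K ⟩
  (k′ * c l + 2 * K) + k′ * (k * K) + 2 * (k * K)
    ≡⟨ cong (λ x → x + k′ * (k * K) + 2 * (k * K)) (orbitCount-closed k′ c c0 rec l) ⟩
  (k * K + 1) + k′ * (k * K) + 2 * (k * K)
    ≡⟨ regroup₃ k′ K ⟩
  k * (k * K) + 1 + (k′ * (2 * K) + 2 * K)
    ∎)
  where
  open ≡-Reasoning
  k K : ℕ
  k = suc k′
  K = k ^ l
  regroup₁ : ∀ k′ C K → k′ * C + 2 * (suc k′ * K) + (k′ * (2 * K) + 2 * K)
                      ≡ k′ * (C + 2 * K) + 2 * (suc k′ * K) + 2 * K
  regroup₁ = solve-∀
  regroup₂ : ∀ k′ C K → k′ * (C + suc k′ * K) + 2 * (suc k′ * K) + 2 * K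
                      ≡ (k′ * C + 2 * K) + k′ * (suc k′ * K) + 2 * (suc k′ * K)
  regroup₂ = solve-∀
  regroup₃ : ∀ k′ K → (suc k′ * K + 1) + k′ * (suc k′ * K) + 2 * (suc k′ * K)
                    ≡ suc k′ * (suc k′ * K) + 1 + (k′ * (2 * K) + 2 * K)
  regroup₃ = solve-∀

matchingExponent : ∀ {k a c K} → 2 ≤ k → a * 2 ≡ k → (k ∸ 1) * c + 2 * K ≡ k * K + 1 →
                   2 * (k ∸ 1) * (a * c) ≡ k * (k * K ∸ 2 * K + 1)
matchingExponent {k} {a} {c} {K} 2≤k 2a≡k closed = begin
  2 * (k ∸ 1) * (a * c)   ≡⟨ regroup (k ∸ 1) a c ⟩
  a * 2 * ((k ∸ 1) * c)   ≡⟨ cong₂ _*_ 2a≡k orbits ⟩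
  k * (k * K ∸ 2 * K + 1) ∎
  where
  open ≡-Reasoning
  regroup : ∀ d a c → 2 * d * (a * c) ≡ a * 2 * (d * c)
  regroup = solve-∀
  orbits : (k ∸ 1) * c ≡ k * K ∸ 2 * K + 1
  orbits = begin
    (k ∸ 1) * c                   ≡⟨ sym (ℕ.m+n∸n≡m _ (2 * K)) ⟩
    ((k ∸ 1) * c + 2 * K) ∸ 2 * K ≡⟨ cong (_∸ 2 * K) closed ⟩
    (k * K + 1) ∸ 2 * K           ≡⟨ ℕ.+-∸-comm 1 (ℕ.*-monoˡ-≤ K 2≤k) ⟩
    k * K ∸ 2 * K + 1             ∎

mainTheorem4 : (k m : ℕ) (edge : Fin m → Fin k × Fin k) →
    IsTree (graphOf edge) → 2 ≤ k → (n : ℕ) → 1 ≤ n →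
    (HasPerfectMatching (graphOf edge) →
       Σ ℕ (λ x → (2 * (k ∸ 1) * x ≡ k * (k ^ n ∸ 2 * k ^ (n ∸ 1) + 1)) ×
                  NumPerfectMatchings (Schreier edge n) (2 ^ x)))
    × (¬ HasPerfectMatching (graphOf edge) → ¬ HasPerfectMatching (Schreier edge n))
mainTheorem4 k@(suc (suc j)) m edge (_ , acyclic) 2≤k@(s≤s (s≤s _)) (suc l) _ = matchable , unmatchable
  where
  open SchreierGraph edge acyclic l

  matchable : HasPerfectMatching G →
              Σ ℕ λ x → (2 * (k ∸ 1) * x ≡ k * (k * k ^ l ∸ 2 * k ^ l + 1)) × NumPerfectMatchings Γ (2 ^ x)
  matchable (μ , μ-pm) = length R , exponent , numPerfectMatchings-Γ
    where
    open Alternation μ-pm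
    i₀ : Fin m
    i₀ = matchedEdge μ-pm zero
    exponent : 2 * (k ∸ 1) * length R ≡ k * (k * k ^ l ∸ 2 * k ^ l + 1)
    exponent = subst (λ x → 2 * (k ∸ 1) * x ≡ _) (sym (length-R i₀))
      (matchingExponent {a = length μEdges} {c = length (Orbit.reps i₀ l)} {K = k ^ l} 2≤k length-μEdges
        (orbitCount-closed (suc j) (λ l → length (Orbit.reps i₀ l)) refl (Orbit.length-reps-suc i₀) l))

  unmatchable : ¬ HasPerfectMatching G → ¬ HasPerfectMatching Γ
  unmatchable ¬G-pm (_ , pm) = ¬G-pm (Labels.inducedMatching pm , Labels.inducedMatching-pm pm)
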